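{- Let $A$, $B$, $C$ be $m \times n$ matrices over $\{ -1,0,1\}$ such that $A$ has an entry $0$ and $(A,B,C)$ is neither independent from $B$ nor independent from $C$. Suppose $A$ and $B$ are not layered matrices and $C$ is a layered matrix. Then ${\rm IST}(A,B,C)=\infty$ if and only if $(A,B,C)$ is an all-but-leftmost-negative triple, i.e., every row of $A$ and every row of $B$ is one of the strings $0(-1)^{n-1}$, $1(-1)^{n-1}$, and $C$ is the all-$(-1)$ matrix.
   Context: Rows of matrices are written as strings; $x^r$ denotes the symbol $x$ repeated $r$ times. For an $m\times n$ matrix $M=[m_{ij}]$ over $\{ -1,0,1\}$, $G_o(M)$ is the directed graph on $\{1,\dots,n+m\}$ with edges $j\to i$ for all $1\le j<i\le n$, and for $1\le p\le m$, $1\le j\le n$: an edge $j\to n+p$ if $m_{pj}=1$, an edge $n+p\to j$ if $m_{pj}=-1$, no edge if $m_{pj}=0$; no edges among $n+1,\dots,n+m$. A directed graph is semi-transitive if it is acyclic and for every directed path $u_1\to\cdots\to u_t$, $t\ge2$, either there is no edge $u_1\to u_t$ or all edges $u_i\to u_j$ ($1\le i<j\le t$) exist. For $m\times n$ matrices $A,B,C$ over $\{ -1,0,1\}$, the morphism $\varphi$ replaces each entry $0,1,-1$ by the block $A,B,C$ respectively; $M^k(A,B,C)=\varphi^k([0])$ and $G_o^k(A,B,C)=G_o(M^k(A,B,C))$. If $A$ has an entry $0$, ${\rm IST}(A,B,C)$ is the least $\ell\ge0$ with $G_o^\ell(A,B,C)$ not semi-transitive, or $\infty$ if none exists. A matrix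 is layered if all entries in each row are identical. $(A,B,C)$ is independent from $B$ if there are no $1$'s in $A$ and $C$; it is independent from $C$ if there are no $(-1)$'s in $A$ and $B$. -}

module Defs where

open import Data.Nat using (ℕ; zero; suc; _^_; _<_; _≤_; _∸_)
open import Data.Fin using (Fin; toℕ; remQuot)
import Data.Fin as F
open import Data.Product using (Σ; ∃; _×_; _,_)
open import Data.Sum using (_⊎_; inj₁; inj₂)
open import Data.Empty using (⊥)
open import Relation.Nullary using (¬_)
open import Relation.Binary.PropositionalEquality using (_≡_; _≢_)

-- Entries over {-1,0,1}:  zer = 0, one = 1, neg = -1
data Entry : Set where
  zer one neg : Entry

Mat : ℕ → ℕ → Set
Mat r c = Fin r → Fin c → Entry

module _ {m n : ℕ} (A B C : Mat m n) where

  block : Entry → Mat m n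
  block zer = A
  block one = B
  block neg = C

  -- φ^k applied to the 1×1 matrix [x]; an m^k × n^k matrix.
  -- φ^(k+1)([x]) = φ^k(φ([x])): block (p,j) (rows/cols ordered with the
  -- block index most significant) is φ^k([ (block x) p j ]).
  φ^ : (k : ℕ) → Entry → Mat (m ^ k) (n ^ k)
  φ^ zero    x _ _ = x
  φ^ (suc k) x I J with remQuot (m ^ k) I | remQuot (n ^ k) J
  ... | p , I' | j , J' = φ^ k (block x p j) I' J'

  Mk : (k : ℕ) → Mat (m ^ k) (n ^ k)
  Mk k = φ^ k zer

-- The graph G_o(M) of an r × c matrix M.  Vertices: inj₁ j for the column
-- vertices 1..c (j ↦ j+1) and inj₂ p for the row vertices c+1..c+r (p ↦ c+p+1).
Vertex : ℕ → ℕ → Set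
Vertex r c = Fin c ⊎ Fin r

data Edge {r c : ℕ} (M : Mat r c) : Vertex r c → Vertex r c → Set where
  col-col : ∀ {j i : Fin c} → toℕ j < toℕ i → Edge M (inj₁ j) (inj₁ i)
  col-row : ∀ {j : Fin c} {p : Fin r} → M p j ≡ one → Edge M (inj₁ j) (inj₂ p)
  row-col : ∀ {j : Fin c} {p : Fin r} → M p j ≡ neg → Edge M (inj₂ p) (inj₁ j)

IsWalk : {V : Set} → (V → V → Set) → ℕ → (ℕ → V) → Set
IsWalk E t u = ∀ i → suc i < t → E (u i) (u (suc i))

Acyclic : {V : Set} → (V → V → Set) → Set
Acyclic {V} E = ¬ (Σ ℕ λ t → Σ (ℕ → V) λ u →
  (2 ≤ t) × IsWalk E t u × (u 0 ≡ u (t ∸ 1)))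

SemiTransitive : {V : Set} → (V → V → Set) → Set
SemiTransitive {V} E = Acyclic E ×
  (∀ (t : ℕ) (u : ℕ → V) → 2 ≤ t → IsWalk E t u →
     E (u 0) (u (t ∸ 1)) → ∀ i j → i < j → j < t → E (u i) (u j))

IST∞ : {m n : ℕ} → Mat m n → Mat m n → Mat m n → Set
IST∞ A B C = ∀ (ℓ : ℕ) → SemiTransitive (Edge (Mk A B C ℓ))

HasEntry : {m n : ℕ} → Entry → Mat m n → Set
HasEntry x M = ∃ λ p → ∃ λ j → M p j ≡ x

NoEntry : {m n : ℕ} → Entry → Mat m n → Set
NoEntry x M = ∀ p j → M p j ≢ x

IndepB : {m n : ℕ} → Mat m n → Mat m n → Mat m n → Set
IndepB A B C = NoEntry one A × NoEntry one C

IndepC : {m n : ℕ} → Mat m n → Mat m n → Mat m n → Set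
IndepC A B C = NoEntry neg A × NoEntry neg B

Layered : {m n : ℕ} → Mat m n → Set
Layered M = ∀ p j j' → M p j ≡ M p j'

RowIs : {c : ℕ} → Entry → (Fin c → Entry) → Set
RowIs x row = ∀ j → row j ≡ lead j
  where
  lead : ∀ {c} → Fin c → Entry
  lead F.zero    = x
  lead (F.suc _) = neg

AllButLeftmostNegative : {m n : ℕ} → Mat m n → Mat m n → Mat m n → Set
AllButLeftmostNegative A B C =
  (∀ p → RowIs zer (A p) ⊎ RowIs one (A p)) ×
  (∀ p → RowIs zer (B p) ⊎ RowIs one (B p)) ×
  (∀ p j → C p j ≡ neg)

module Submission where

-- If A and B have rows 0(-1)^(n-1) or 1(-1)^(n-1) and C is all -1, then in every M^k an
-- entry is -1 exactly when it is not in the first column, which makes G_o(M^k) transitive.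
-- Conversely, semi-transitivity forbids a row containing -1 before 1, 1 0 1, or -1 0 -1,
-- hence any alternating x y x y. So an entry x ≠ -1 cannot repeat in a row of M^k, or
-- φ(x) ∈ {A, B} would be layered. This forces C = -1, a 1 in A, and then that every entry
-- of M^k with something to its left is -1. Read at levels 1 and 2 this gives the tails of
-- the rows of A and B; their first entries are not -1, as no two rows of any M^k may read
-- (-1,-1) and (1,-1) in the same two columns.

open import Defs
open import Data.Nat using (ℕ; zero; suc; _^_; _<_; _≤_; _+_; _*_; z≤n; s≤s; z<s)
import Data.Nat.Properties as ℕ
open import Data.Fin using (Fin; zero; suc; toℕ; remQuot; combine)
import Data.Fin.Properties as Fin
open import Data.Product using (_×_; _,_; proj₁; proj₂)
open import Data.Sum using (_⊎_; inj₁; inj₂; [_,_])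
open import Data.Empty using (⊥; ⊥-elim)
open import Relation.Nullary using (¬_; yes; no; ¬?)
open import Relation.Nullary.Decidable using (decidable-stable)
open import Relation.Binary using (Transitive; DecidableEquality; tri<; tri≈; tri>)
open import Relation.Binary.PropositionalEquality
  using (_≡_; _≢_; refl; sym; trans; cong; cong₂; subst; subst₂; module ≡-Reasoning)
open import Function.Base using (_∘_)
open import Function.Bundles using (_⇔_; mk⇔; Equivalence)

-- φ^ splits an index most-significant digit first; refine appends a least-significant
-- digit q, indexing row q of the block that row I of M^k becomes in M^(k+1).

refine : ∀ {m} k → Fin (m ^ k) → Fin m → Fin (m ^ suc k)
refine zero    I q = combine q I
refine {m} (suc k) I q with remQuot {m} (m ^ k) I
... | p , I′ = combine p (refine k I′ q)

toℕ-refine : ∀ {m} k (I : Fin (m ^ k)) (q : Fin m) → toℕ (refine k I q) ≡ m * toℕ I + toℕ q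
toℕ-refine {m} zero zero q = begin
  toℕ (combine q zero)  ≡⟨ Fin.toℕ-combine q zero ⟩
  1 * toℕ q + 0         ≡⟨ ℕ.+-identityʳ _ ⟩
  1 * toℕ q             ≡⟨ ℕ.*-identityˡ _ ⟩
  toℕ q                 ≡⟨ cong (_+ toℕ q) (ℕ.*-zeroʳ m) ⟨
  m * 0 + toℕ q         ∎
  where open ≡-Reasoning
toℕ-refine {m} (suc k) I q = begin
  toℕ (combine p (refine k I′ q))             ≡⟨ Fin.toℕ-combine p (refine k I′ q) ⟩
  m * m ^ k * toℕ p + toℕ (refine k I′ q)     ≡⟨ cong (m * m ^ k * toℕ p +_) (toℕ-refine k I′ q) ⟩
  m * m ^ k * toℕ p + (m * toℕ I′ + toℕ q)   ≡⟨ cong (_+ (m * toℕ I′ + toℕ q)) (ℕ.*-assoc m (m ^ k) (toℕ p)) ⟩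
  m * (m ^ k * toℕ p) + (m * toℕ I′ + toℕ q) ≡⟨ ℕ.+-assoc (m * (m ^ k * toℕ p)) (m * toℕ I′) (toℕ q) ⟨
  m * (m ^ k * toℕ p) + m * toℕ I′ + toℕ q   ≡⟨ cong (_+ toℕ q) (ℕ.*-distribˡ-+ m (m ^ k * toℕ p) (toℕ I′)) ⟨
  m * (m ^ k * toℕ p + toℕ I′) + toℕ q        ≡⟨ cong (λ i → m * i + toℕ q) (Fin.toℕ-combine p I′) ⟨
  m * toℕ (combine p I′) + toℕ q              ≡⟨ cong (λ i → m * toℕ i + toℕ q) (Fin.combine-remQuot {m} (m ^ k) I) ⟩
  m * toℕ I + toℕ q                           ∎
  where
  open ≡-Reasoning
  p = proj₁ (remQuot {m} (m ^ k) I)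
  I′ = proj₂ (remQuot {m} (m ^ k) I)

refine-monoʳ-< : ∀ {m} k (I : Fin (m ^ k)) {q q′ : Fin m} →
                 toℕ q < toℕ q′ → toℕ (refine k I q) < toℕ (refine k I q′)
refine-monoʳ-< {m} k I {q} {q′} q<q′
  rewrite toℕ-refine k I q | toℕ-refine k I q′ = ℕ.+-monoʳ-< (m * toℕ I) q<q′

refine-monoˡ-< : ∀ {m} k {I I′ : Fin (m ^ k)} (q q′ : Fin m) →
                 toℕ I < toℕ I′ → toℕ (refine k I q) < toℕ (refine k I′ q′)
refine-monoˡ-< k {I} {I′} q q′ I<I′
  rewrite toℕ-refine k I q | toℕ-refine k I′ q′
        | sym (Fin.toℕ-combine I q) | sym (Fin.toℕ-combine I′ q′) = Fin.combine-monoˡ-< q q′ I<I′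

module _ {m n : ℕ} (A B C : Mat m n) where

  φ^-combine : ∀ k x p (I : Fin (m ^ k)) j (J : Fin (n ^ k)) →
               φ^ A B C (suc k) x (combine p I) (combine j J) ≡ φ^ A B C k (block A B C x p j) I J
  φ^-combine k x p I j J =
    cong₂ (λ (pI : Fin m × Fin (m ^ k)) (jJ : Fin n × Fin (n ^ k)) → φ^ A B C k (block A B C x (proj₁ pI) (proj₁ jJ)) (proj₂ pI) (proj₂ jJ))
          (Fin.remQuot-combine p I) (Fin.remQuot-combine j J)

  φ^-refine : ∀ k x I J q j →
              φ^ A B C (suc k) x (refine k I q) (refine k J j) ≡ block A B C (φ^ A B C k x I J) q j
  φ^-refine zero    x I J q j = φ^-combine zero x q I j J
  φ^-refine (suc k) x I J q j =
    trans (φ^-combine (suc k) x (proj₁ (remQuot {m} (m ^ k) I)) _ (proj₁ (remQuot {n} (n ^ k) J)) _)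
          (φ^-refine k _ (proj₂ (remQuot {m} (m ^ k) I)) (proj₂ (remQuot {n} (n ^ k) J)) q j)

module _ {V : Set} {E : V → V → Set} where

  walk₄ : V → V → V → V → ℕ → V
  walk₄ a b c d 0 = a
  walk₄ a b c d 1 = b
  walk₄ a b c d 2 = c
  walk₄ a b c d _ = d

  walk₄-isWalk : ∀ {a b c d} → E a b → E b c → E c d → IsWalk E 4 (walk₄ a b c d)
  walk₄-isWalk ab bc cd 0 _ = ab
  walk₄-isWalk ab bc cd 1 _ = bc
  walk₄-isWalk ab bc cd 2 _ = cd
  walk₄-isWalk ab bc cd (suc (suc (suc _))) (s≤s (s≤s (s≤s (s≤s ()))))

  Acyclic⇒¬3-cycle : Acyclic E → ∀ {a b c} → E a b → E b c → E c a → ⊥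
  Acyclic⇒¬3-cycle acyclic ab bc ca =
    acyclic (4 , walk₄ _ _ _ _ , s≤s (s≤s z≤n) , walk₄-isWalk ab bc ca , refl)

  SemiTransitive⇒chords : SemiTransitive E → ∀ {a b c d} →
                          E a b → E b c → E c d → E a d → E a c × E b d
  SemiTransitive⇒chords (_ , shortcut) ab bc cd ad =
    edge 0 2 (s≤s z≤n) (s≤s (s≤s (s≤s z≤n))) , edge 1 3 (s≤s (s≤s z≤n)) ℕ.≤-refl
    where edge = shortcut 4 (walk₄ _ _ _ _) (s≤s (s≤s z≤n)) (walk₄-isWalk ab bc cd) ad

  walk⇒edge : Transitive E → ∀ t u → IsWalk E t u → ∀ i j → i < j → j < t → E (u i) (u j)
  walk⇒edge trans t u walk i (suc j) i<1+j 1+j<t with ℕ.m<1+n⇒m<n∨m≡n i<1+j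
  ... | inj₂ refl = walk i 1+j<t
  ... | inj₁ i<j  = trans (walk⇒edge trans t u walk i j i<j (ℕ.<-trans (ℕ.n<1+n j) 1+j<t)) (walk j 1+j<t)

  transitive⇒semiTransitive : Transitive E → (∀ {a} → ¬ E a a) → SemiTransitive E
  transitive⇒semiTransitive trans irrefl = acyclic , λ t u _ walk _ → walk⇒edge trans t u walk
    where
    acyclic : Acyclic E
    acyclic (suc (suc t) , u , s≤s (s≤s z≤n) , walk , u₀≡uₜ) =
      irrefl (subst (E (u 0)) (sym u₀≡uₜ) (walk⇒edge trans _ u walk 0 (suc t) (s≤s z≤n) ℕ.≤-refl))

module RowPatterns {r c : ℕ} (M : Mat r c) (st : SemiTransitive (Edge M)) where

  ¬neg<one : ∀ {p a b} → toℕ a < toℕ b → M p a ≡ neg → M p b ≡ one → ⊥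
  ¬neg<one a<b Ma Mb = Acyclic⇒¬3-cycle {E = Edge M} (proj₁ st) (row-col Ma) (col-col a<b) (col-row Mb)

  ¬one<zer<one : ∀ {p a b d} → toℕ a < toℕ b → toℕ b < toℕ d →
                 M p a ≡ one → M p b ≡ zer → M p d ≡ one → ⊥
  ¬one<zer<one a<b b<d Ma Mb Md
    with SemiTransitive⇒chords {E = Edge M} st (col-col a<b) (col-col b<d) (col-row Md) (col-row Ma)
  ... | _ , col-row Mb′ with () ← trans (sym Mb) Mb′

  ¬neg<zer<neg : ∀ {p a b d} → toℕ a < toℕ b → toℕ b < toℕ d →
                 M p a ≡ neg → M p b ≡ zer → M p d ≡ neg → ⊥
  ¬neg<zer<neg a<b b<d Ma Mb Md
    with SemiTransitive⇒chords {E = Edge M} st (row-col Ma) (col-col a<b) (col-col b<d) (row-col Md)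
  ... | row-col Mb′ , _ with () ← trans (sym Mb) Mb′

  ¬alternating : ∀ {p a b d e} x y → x ≢ y → toℕ a < toℕ b → toℕ b < toℕ d → toℕ d < toℕ e →
                 M p a ≡ x → M p b ≡ y → M p d ≡ x → M p e ≡ y → ⊥
  ¬alternating zer zer x≢y _ _ _ _ _ _ _ = x≢y refl
  ¬alternating one one x≢y _ _ _ _ _ _ _ = x≢y refl
  ¬alternating neg neg x≢y _ _ _ _ _ _ _ = x≢y refl
  ¬alternating zer one _ _   b<d d<e _  Mb Md Me = ¬one<zer<one b<d d<e Mb Md Me
  ¬alternating one zer _ a<b b<d _   Ma Mb Md _  = ¬one<zer<one a<b b<d Ma Mb Md
  ¬alternating zer neg _ _   b<d d<e _  Mb Md Me = ¬neg<zer<neg b<d d<e Mb Md Me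
  ¬alternating neg zer _ a<b b<d _   Ma Mb Md _  = ¬neg<zer<neg a<b b<d Ma Mb Md
  ¬alternating one neg _ _   b<d _   _  Mb Md _  = ¬neg<one b<d Mb Md
  ¬alternating neg one _ a<b _   _   Ma Mb _  _  = ¬neg<one a<b Ma Mb

  -- The walk s → a → q → b has the shortcut s → b, but rows are never adjacent.
  ¬neg,neg-above-one,neg : ∀ {s q a b} → toℕ a < toℕ b →
                           M s a ≡ neg → M s b ≡ neg → M q a ≡ one → M q b ≡ neg → ⊥
  ¬neg,neg-above-one,neg a<b Msa Msb Mqa Mqb
    with SemiTransitive⇒chords {E = Edge M} st (row-col Msa) (col-row Mqa) (row-col Mqb) (row-col Msb)
  ... | () , _

_≟_ : DecidableEquality Entry
zer ≟ zer = yes refl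
one ≟ one = yes refl
neg ≟ neg = yes refl
zer ≟ one = no λ ()
zer ≟ neg = no λ ()
one ≟ zer = no λ ()
one ≟ neg = no λ ()
neg ≟ zer = no λ ()
neg ≟ one = no λ ()

neg≢one : neg ≢ one
neg≢one ()

module _ {r c : ℕ} (M : Mat r c) where

  layered-from-ordered : (∀ p {j j′} → toℕ j < toℕ j′ → ¬ M p j ≢ M p j′) → Layered M
  layered-from-ordered ordered p j j′ with M p j ≟ M p j′
  ... | yes eq = eq
  ... | no neq with ℕ.<-cmp (toℕ j) (toℕ j′)
  ...   | tri< j<j′ _ _ = ⊥-elim (ordered p j<j′ neq)
  ...   | tri≈ _ j≡j′ _ = ⊥-elim (neq (cong (M p) (Fin.toℕ-injective j≡j′)))
  ...   | tri> _ _ j′<j = ⊥-elim (ordered p j′<j (neq ∘ sym))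

  ¬NoEntry⇒HasEntry : ∀ {x} → ¬ NoEntry x M → HasEntry x M
  ¬NoEntry⇒HasEntry {x} ¬none
    with p , ¬rowFree ← Fin.¬∀⟶∃¬ r _ (λ p → Fin.all? λ j → ¬? (M p j ≟ x)) ¬none
    with j , ¬Mpj≢x ← Fin.¬∀⟶∃¬ c _ (λ j → ¬? (M p j ≟ x)) ¬rowFree
    = p , j , decidable-stable (M p j ≟ x) ¬Mpj≢x

  all-zer⇒layered : NoEntry one M → NoEntry neg M → Layered M
  all-zer⇒layered no-one no-neg p j j′ = trans (zer-at j) (sym (zer-at j′))
    where
    zer-at : ∀ j → M p j ≡ zer
    zer-at j with M p j in Mpj
    ... | zer = refl
    ... | one = ⊥-elim (no-one p j Mpj)
    ... | neg = ⊥-elim (no-neg p j Mpj)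

NegPastFirst : ∀ {c} → (Fin c → Entry) → Set
NegPastFirst row = ∀ j → row j ≡ neg ⇔ 0 < toℕ j

RowIs⇒NegPastFirst : ∀ {c x} {row : Fin c → Entry} → x ≢ neg → RowIs x row → NegPastFirst row
RowIs⇒NegPastFirst x≢neg row≡ zero    = mk⇔ (λ row₀≡neg → ⊥-elim (x≢neg (trans (sym (row≡ zero)) row₀≡neg))) λ ()
RowIs⇒NegPastFirst x≢neg row≡ (suc j) = mk⇔ (λ _ → z<s) (λ _ → row≡ (suc j))

zer-or-one⇒NegPastFirst : ∀ {c} {row : Fin c → Entry} → RowIs zer row ⊎ RowIs one row → NegPastFirst row
zer-or-one⇒NegPastFirst = [ RowIs⇒NegPastFirst (λ ()) , RowIs⇒NegPastFirst (λ ()) ]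

module _ {r c : ℕ} (M : Mat r c) (rows : ∀ p → NegPastFirst (M p)) where

  private
    neg⇒0< : ∀ {p j} → M p j ≡ neg → 0 < toℕ j
    neg⇒0< {p} {j} = Equivalence.to (rows p j)

    one⇒≤0 : ∀ {p j} → M p j ≡ one → toℕ j ≤ 0
    one⇒≤0 {p} {j} Mpj≡one = ℕ.≮⇒≥ λ 0<j → neg≢one (trans (sym (Equivalence.from (rows p j) 0<j)) Mpj≡one)

  Edge-transitive : Transitive (Edge M)
  Edge-transitive (col-col j<i)  (col-col i<h)  = col-col (ℕ.<-trans j<i i<h)
  Edge-transitive (col-col j<i)  (col-row Mpi)  = ⊥-elim (ℕ.n≮0 (ℕ.<-≤-trans j<i (one⇒≤0 Mpi)))
  Edge-transitive (col-row Mpj)  (row-col Mpi)  = col-col (ℕ.≤-<-trans (one⇒≤0 Mpj) (neg⇒0< Mpi))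
  Edge-transitive (row-col Mpj)  (col-col j<i)  = row-col (Equivalence.from (rows _ _) (ℕ.<-trans (neg⇒0< Mpj) j<i))
  Edge-transitive (row-col Mpj)  (col-row Mp′j) = ⊥-elim (ℕ.n≮0 (ℕ.<-≤-trans (neg⇒0< Mpj) (one⇒≤0 Mp′j)))

  Edge-irreflexive : ∀ {v} → ¬ Edge M v v
  Edge-irreflexive (col-col j<j) = ℕ.<-irrefl refl j<j

  NegPastFirst⇒semiTransitive : SemiTransitive (Edge M)
  NegPastFirst⇒semiTransitive = transitive⇒semiTransitive {E = Edge M} Edge-transitive Edge-irreflexive

module Sufficiency {m n : ℕ} (A B C : Mat m n) (abln : AllButLeftmostNegative A B C) where

  C≡neg : ∀ q j → C q j ≡ neg
  C≡neg = proj₂ (proj₂ abln)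

  block-NegPastFirst : ∀ {x} → x ≢ neg → ∀ p → NegPastFirst (block A B C x p)
  block-NegPastFirst {zer} _ p = zer-or-one⇒NegPastFirst (proj₁ abln p)
  block-NegPastFirst {one} _ p = zer-or-one⇒NegPastFirst (proj₁ (proj₂ abln) p)
  block-NegPastFirst {neg} x≢neg = ⊥-elim (x≢neg refl)

  φ^-neg : ∀ k I J → φ^ A B C k neg I J ≡ neg
  φ^-neg zero    _ _ = refl
  φ^-neg (suc k) I J = trans (cong (λ x → φ^ A B C k x _ _) (C≡neg _ _)) (φ^-neg k _ _)

  φ^-NegPastFirst : ∀ k {x} → x ≢ neg → ∀ I → NegPastFirst (φ^ A B C k x I)
  φ^-NegPastFirst zero    x≢neg _ zero = mk⇔ (⊥-elim ∘ x≢neg) λ ()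
  φ^-NegPastFirst (suc k) {x} x≢neg I J =
    subst (λ J → φ^ A B C (suc k) x I J ≡ neg ⇔ 0 < toℕ J) (Fin.combine-remQuot {n} (n ^ k) J)
          (at-combine (proj₁ (remQuot {n} (n ^ k) J)) (proj₂ (remQuot {n} (n ^ k) J)))
    where
    p = proj₁ (remQuot {m} (m ^ k) I)
    I′ = proj₂ (remQuot {m} (m ^ k) I)

    entry : ∀ j J′ → φ^ A B C (suc k) x I (combine j J′) ≡ φ^ A B C k (block A B C x p j) I′ J′
    entry j J′ = cong (λ (jJ′ : Fin n × Fin (n ^ k)) → φ^ A B C k (block A B C x p (proj₁ jJ′)) I′ (proj₂ jJ′))
                      (Fin.remQuot-combine j J′)

    at-combine : ∀ j J′ → φ^ A B C (suc k) x I (combine j J′) ≡ neg ⇔ 0 < toℕ (combine j J′)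
    at-combine zero J′ = subst₂ (λ y i → y ≡ neg ⇔ 0 < i) (sym (entry zero J′)) (sym (Fin.toℕ-↑ˡ J′ _))
      (φ^-NegPastFirst k (λ eq → ℕ.<-irrefl refl (Equivalence.to (block-NegPastFirst x≢neg p zero) eq)) I′ J′)
    at-combine (suc j) J′ = mk⇔
      (λ _ → ℕ.m<n⇒0<n (Fin.combine-monoˡ-< J′ J′ (z<s {n = toℕ j})))
      (λ _ → trans (entry (suc j) J′)
               (trans (cong (λ y → φ^ A B C k y I′ J′) (Equivalence.from (block-NegPastFirst x≢neg p (suc j)) z<s))
                      (φ^-neg k I′ J′)))

  sufficiency : IST∞ A B C
  sufficiency ℓ = NegPastFirst⇒semiTransitive (Mk A B C ℓ) (φ^-NegPastFirst ℓ (λ ()))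

row-shape : ∀ {c} (row : Fin (suc c) → Entry) →
            (∀ j → row (suc j) ≡ neg) → row zero ≢ neg → RowIs zer row ⊎ RowIs one row
row-shape row tail head with row zero in row₀
... | zer = inj₁ λ { zero → row₀ ; (suc j) → tail j }
... | one = inj₂ λ { zero → row₀ ; (suc j) → tail j }
... | neg = ⊥-elim (head refl)

module Necessity {m n : ℕ} (A B C : Mat m (suc (suc n))) (ist : IST∞ A B C)
                 (¬layered-A : ¬ Layered A) (¬layered-B : ¬ Layered B) where

  M : ∀ k → Mat (m ^ k) (suc (suc n) ^ k)
  M = Mk A B C

  φ : Entry → Mat m (suc (suc n))
  φ = block A B C

  module R k = RowPatterns (M k) (ist k)

  M-refine : ∀ k {I J x} q j → M k I J ≡ x → M (suc k) (refine k I q) (refine k J j) ≡ φ x q j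
  M-refine k q j MIJ = trans (φ^-refine A B C k zer _ _ q j) (cong (λ x → φ x q j) MIJ)

  row₁ : Fin m → Fin (m ^ 1)
  row₁ = refine 0 zero

  col₁ : Fin (suc (suc n)) → Fin (suc (suc n) ^ 1)
  col₁ = refine 0 zero

  row₂ : Fin m → Fin m → Fin (m ^ 2)
  row₂ p = refine 1 (row₁ p)

  col₂ : Fin (suc (suc n)) → Fin (suc (suc n)) → Fin (suc (suc n) ^ 2)
  col₂ j = refine 1 (col₁ j)

  col₁-0< : ∀ j → toℕ (col₁ zero) < toℕ (col₁ (suc j))
  col₁-0< j = refine-monoʳ-< {suc (suc n)} 0 zero {zero} {suc j} z<s

  col₂-0< : ∀ j j′ → toℕ (col₂ j zero) < toℕ (col₂ j (suc j′))
  col₂-0< j j′ = refine-monoʳ-< {suc (suc n)} 1 (col₁ j) {zero} {suc j′} z<s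

  M₁ : ∀ p j → M 1 (row₁ p) (col₁ j) ≡ A p j
  M₁ p j = M-refine 0 p j refl

  M₂ : ∀ {p j x} q j′ → A p j ≡ x → M 2 (row₂ p q) (col₂ j j′) ≡ φ x q j′
  M₂ {p} {j} q j′ Apj = M-refine 1 {row₁ p} {col₁ j} q j′ (trans (M₁ p j) Apj)

  -- In M^(k+1) the two copies of φ x lie side by side, so each row of φ x is followed by
  -- itself; it alternates unless it is constant.
  repeat⇒layered : ∀ k {I J J′ x} → toℕ J < toℕ J′ → M k I J ≡ x → M k I J′ ≡ x → Layered (φ x)
  repeat⇒layered k {I} {J} {J′} J<J′ MJ MJ′ = layered-from-ordered (φ _) λ p {j} {j′} j<j′ neq →
    R.¬alternating (suc k) _ _ neq
      (refine-monoʳ-< k J j<j′) (refine-monoˡ-< k j′ j J<J′) (refine-monoʳ-< k J′ j<j′)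
      (M-refine k p j MJ) (M-refine k p j′ MJ) (M-refine k p j MJ′) (M-refine k p j′ MJ′)

  ¬layered-φ : ∀ {x} → x ≢ neg → ¬ Layered (φ x)
  ¬layered-φ {zer} _ = ¬layered-A
  ¬layered-φ {one} _ = ¬layered-B
  ¬layered-φ {neg} x≢neg = ⊥-elim (x≢neg refl)

  ¬repeat : ∀ k {I J J′ x} → x ≢ neg → toℕ J < toℕ J′ → M k I J ≡ x → M k I J′ ≡ x → ⊥
  ¬repeat k x≢neg J<J′ MJ MJ′ = ¬layered-φ x≢neg (repeat⇒layered k J<J′ MJ MJ′)

  left-of-one-is-zer : ∀ k {I J J′} → toℕ J < toℕ J′ → M k I J′ ≡ one → M k I J ≡ zer
  left-of-one-is-zer k {I} {J} J<J′ MJ′ with M k I J in MJ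
  ... | zer = refl
  ... | one = ⊥-elim (¬repeat k (λ ()) J<J′ MJ MJ′)
  ... | neg = ⊥-elim (R.¬neg<one k J<J′ MJ MJ′)

  ¬two-left-of-one : ∀ k {I J₁ J₂ J′} → toℕ J₁ < toℕ J₂ → toℕ J₂ < toℕ J′ → M k I J′ ≢ one
  ¬two-left-of-one k J₁<J₂ J₂<J′ MJ′ = ¬repeat k (λ ()) J₁<J₂
    (left-of-one-is-zer k (ℕ.<-trans J₁<J₂ J₂<J′) MJ′) (left-of-one-is-zer k J₂<J′ MJ′)

  neg-free : ∀ {q x} → x ≢ neg → (∀ j → C q j ≡ x) → ∀ k {I J} → M k I J ≢ neg
  neg-free {q} x≢neg Cq k {I} {J} MIJ = ¬repeat (suc k) x≢neg (refine-monoʳ-< k J z<s)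
    (trans (M-refine k q zero MIJ) (Cq zero)) (trans (M-refine k q (suc zero) MIJ) (Cq (suc zero)))

  constant-row⇒IndepC : ∀ {q x} → x ≢ neg → (∀ j → C q j ≡ x) → IndepC A B C
  constant-row⇒IndepC x≢neg Cq = no-neg-A , no-neg-B A-has-one
    where
    no-neg-A : NoEntry neg A
    no-neg-A p j Apj = neg-free x≢neg Cq 1 {row₁ p} {col₁ j} (trans (M₁ p j) Apj)

    A-has-one : HasEntry one A
    A-has-one = ¬NoEntry⇒HasEntry A λ no-one → ¬layered-A (all-zer⇒layered A no-one no-neg-A)

    no-neg-B : HasEntry one A → NoEntry neg B
    no-neg-B (q₁ , j₁ , Aq₁j₁) p j Bpj =
      neg-free x≢neg Cq 2 {row₂ q₁ p} {col₂ j₁ j} (trans (M₂ p j Aq₁j₁) Bpj)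

  C-neg : Layered C → ¬ IndepC A B C → ∀ q j → C q j ≡ neg
  C-neg layered-C ¬indepC q j with C q j ≟ neg
  ... | yes Cqj≡neg = Cqj≡neg
  ... | no  Cqj≢neg = ⊥-elim (¬indepC (constant-row⇒IndepC Cqj≢neg λ j′ → layered-C q j′ j))

  one-in-A : (∀ q j → C q j ≡ neg) → ¬ IndepB A B C → HasEntry one A
  one-in-A C≡neg ¬indepB = ¬NoEntry⇒HasEntry A λ no-one →
    ¬indepB (no-one , λ q j C≡one → neg≢one (trans (sym (C≡neg q j)) C≡one))

  module _ (C≡neg : ∀ q j → C q j ≡ neg) {q₁ j₁} (Aq₁j₁ : A q₁ j₁ ≡ one) where

    ¬one<zer : ∀ k {I J J′} → toℕ J < toℕ J′ → M k I J ≡ one → M k I J′ ≡ zer → ⊥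
    ¬one<zer k {I} {J} J<J′ MJ MJ′ =
      ¬two-left-of-one (suc k) (refine-monoʳ-< k J z<s) (refine-monoˡ-< k (suc zero) j₁ J<J′)
        (trans (M-refine k q₁ j₁ MJ′) Aq₁j₁)

    ¬neg<zer : ∀ k {I J J′} → toℕ J < toℕ J′ → M k I J ≡ neg → M k I J′ ≡ zer → ⊥
    ¬neg<zer k J<J′ MJ MJ′ = R.¬neg<one (suc k) (refine-monoˡ-< k j₁ j₁ J<J′)
      (trans (M-refine k q₁ j₁ MJ) (C≡neg q₁ j₁)) (trans (M-refine k q₁ j₁ MJ′) Aq₁j₁)

    zer-leftmost : ∀ k {I J J′} → toℕ J < toℕ J′ → M k I J′ ≢ zer
    zer-leftmost k {I} {J} J<J′ MJ′ with M k I J in MJ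
    ... | zer = ¬repeat k (λ ()) J<J′ MJ MJ′
    ... | one = ¬one<zer k J<J′ MJ MJ′
    ... | neg = ¬neg<zer k J<J′ MJ MJ′

    one-leftmost : ∀ k {I J J′} → toℕ J < toℕ J′ → M k I J′ ≢ one
    -- Below the one at J′, M^(k+1) holds a copy of B with two columns to its left.
    one-leftmost k {I} {J} J<J′ MJ′ = ¬layered-B λ q j j′ → trans (B-neg q j) (sym (B-neg q j′))
      where
      B-neg : ∀ q j → B q j ≡ neg
      B-neg q j with B q j in Bqj
      ... | neg = refl
      ... | zer = ⊥-elim (zer-leftmost (suc k) (refine-monoˡ-< k zero j J<J′) (trans (M-refine k q j MJ′) Bqj))
      ... | one = ⊥-elim (¬two-left-of-one (suc k) (refine-monoʳ-< k J z<s)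
                            (refine-monoˡ-< k (suc zero) j J<J′) (trans (M-refine k q j MJ′) Bqj))

    neg-if-not-leftmost : ∀ k {I J J′} → toℕ J < toℕ J′ → M k I J′ ≡ neg
    neg-if-not-leftmost k {I} {J} {J′} J<J′ with M k I J′ in MJ′
    ... | neg = refl
    ... | zer = ⊥-elim (zer-leftmost k J<J′ MJ′)
    ... | one = ⊥-elim (one-leftmost k J<J′ MJ′)

    A-tail : ∀ p j → A p (suc j) ≡ neg
    A-tail p j = trans (sym (M₁ p (suc j))) (neg-if-not-leftmost 1 {row₁ p} {col₁ zero} {col₁ (suc j)} (col₁-0< j))

    A-nonneg-leftmost : ∀ {p j x} → x ≢ neg → A p j ≡ x → A p zero ≡ x
    A-nonneg-leftmost {j = zero}    _      Apj = Apj
    A-nonneg-leftmost {p} {suc j} x≢neg Apj = ⊥-elim (x≢neg (trans (sym Apj) (A-tail p j)))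

    Aq₁0 : A q₁ zero ≡ one
    Aq₁0 = A-nonneg-leftmost (λ ()) Aq₁j₁

    A-head : ∀ p → A p zero ≢ neg
    A-head p Ap0 = R.¬neg,neg-above-one,neg 1 {row₁ p} {row₁ q₁} {col₁ zero} {col₁ (suc zero)}
      (col₁-0< zero)
      (trans (M₁ p zero) Ap0) (trans (M₁ p (suc zero)) (A-tail p zero))
      (trans (M₁ q₁ zero) Aq₁0) (trans (M₁ q₁ (suc zero)) (A-tail q₁ zero))

    B-tail : ∀ q j → B q (suc j) ≡ neg
    B-tail q j = trans (sym (M₂ q (suc j) Aq₁j₁))
                       (neg-if-not-leftmost 2 {row₂ q₁ q} {col₂ j₁ zero} {col₂ j₁ (suc j)}
                         (col₂-0< j₁ j))

    B-head : ∀ {p₀} → A p₀ zero ≡ zer → ∀ q → B q zero ≢ neg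
    B-head {p₀} Ap₀0 q Bq0 = R.¬neg,neg-above-one,neg 2
      {row₂ q₁ q} {row₂ p₀ q₁} {col₂ zero zero} {col₂ zero (suc zero)}
      (col₂-0< zero zero)
      (trans (M₂ q zero Aq₁0) Bq0) (trans (M₂ q (suc zero) Aq₁0) (B-tail q zero))
      (trans (M₂ q₁ zero Ap₀0) Aq₁0) (trans (M₂ q₁ (suc zero) Ap₀0) (A-tail q₁ zero))

    rows-allButLeftmostNegative : HasEntry zer A → AllButLeftmostNegative A B C
    rows-allButLeftmostNegative (_ , _ , Ap₀j₀) =
      (λ p → row-shape (A p) (A-tail p) (A-head p)) ,
      (λ q → row-shape (B q) (B-tail q) (B-head (A-nonneg-leftmost (λ ()) Ap₀j₀) q)) ,
      C≡neg

  necessity : Layered C → ¬ IndepC A B C → ¬ IndepB A B C → HasEntry zer A → AllButLeftmostNegative A B C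
  necessity layered-C ¬indepC ¬indepB with C≡neg ← C-neg layered-C ¬indepC
    with _ , _ , Aq₁j₁ ← one-in-A C≡neg ¬indepB = rows-allButLeftmostNegative C≡neg Aq₁j₁

theorem3p16 : ∀ {m n : ℕ} (A B C : Mat m n) →
    HasEntry zer A → ¬ IndepB A B C → ¬ IndepC A B C →
    ¬ Layered A → ¬ Layered B → Layered C →
    (IST∞ A B C ⇔ AllButLeftmostNegative A B C)
theorem3p16 {n = zero}        A B C _ _ _ ¬layered-A _ _ = ⊥-elim (¬layered-A λ _ ())
theorem3p16 {n = suc zero}    A B C _ _ _ ¬layered-A _ _ = ⊥-elim (¬layered-A λ { _ zero zero → refl })
theorem3p16 {n = suc (suc _)} A B C zer-in-A ¬indepB ¬indepC ¬layered-A ¬layered-B layered-C = mk⇔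
  (λ ist → Necessity.necessity A B C ist ¬layered-A ¬layered-B layered-C ¬indepC ¬indepB zer-in-A)
  (Sufficiency.sufficiency A B C)
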